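{- Let $m > 0$ and $d > 2$ be integers with $m < \tfrac{4}{3}\cdot 2^d + 1$. Then there exist an integer $n$ with $1 \le n \le d$ and a sequence of integers $(a_1,\ldots,a_n)$ with $a_n$ odd, with \[ m = (2^n + 1) + a_1(2^{n-1}+1) + \cdots + a_{n-1}(2^1+1) + a_n, \] and with $2$-weight \[ w_2((a_1,\ldots,a_n)) = \left|\frac{a_n}{2\cdot 2^{n/2}}\right| + \sum_{i=1}^{n-1}\left|\frac{a_i}{2^{i/2}}\right| < 1. \]
   Context: A sequence of integers $(a_1,\ldots,a_n)$ is said to represent $m$ if $m = (2^n + 1) + \sum_{i=1}^{n-1} a_i(2^{n-i}+1) + a_n$. -}

module Defs where

open import Data.Nat as ℕ using (ℕ; zero; suc)
open import Data.Integer as ℤ using (ℤ)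
open import Data.Rational as ℚ using (ℚ; 0ℚ; 1ℚ; ½)
open import Data.Fin using (Fin; toℕ; inject₁; fromℕ)
open import Data.Product using (Σ; ∃-syntax; _×_)
open import Data.Sum using (_⊎_)
open import Data.Empty using (⊥)
open import Relation.Binary.PropositionalEquality using (_≡_)

Oddℤ : ℤ → Set
Oddℤ x = ∃[ k ] x ≡ ℤ.+ 2 ℤ.* k ℤ.+ ℤ.1ℤ

Σℤ : ∀ {n} → (Fin n → ℤ) → ℤ
Σℤ {zero}  f = ℤ.0ℤ
Σℤ {suc n} f = f Data.Fin.zero ℤ.+ Σℤ (λ j → f (Data.Fin.suc j))

-- Elements of ℚ(√2): a pair (r , s) stands for r + s·√2.
record ℚ√2 : Set where
  constructor _+_√2
  field
    rat : ℚ
    irr : ℚ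
open ℚ√2 public

zero√2 : ℚ√2
zero√2 = 0ℚ + 0ℚ √2

_⊕_ : ℚ√2 → ℚ√2 → ℚ√2
(a + b √2) ⊕ (c + d √2) = (a ℚ.+ c) + (b ℚ.+ d) √2

_⊙_ : ℚ → ℚ√2 → ℚ√2
q ⊙ (a + b √2) = (q ℚ.* a) + (q ℚ.* b) √2

Σ√2 : ∀ {n} → (Fin n → ℚ√2) → ℚ√2
Σ√2 {zero}  f = zero√2
Σ√2 {suc n} f = f Data.Fin.zero ⊕ Σ√2 (λ j → f (Data.Fin.suc j))

-- 2^{-i/2} as an element of ℚ(√2):  2^0 = 1,  2^{-1/2} = ½·√2,  2^{-(i+2)/2} = ½ · 2^{-i/2}.
invSqrt2Pow : ℕ → ℚ√2
invSqrt2Pow zero = 1ℚ + 0ℚ √2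
invSqrt2Pow (suc zero) = 0ℚ + ½ √2
invSqrt2Pow (suc (suc i)) = ½ ⊙ invSqrt2Pow i

-- The real number r + s√2 is < 1, i.e. s·√2 < c where c = 1 - r (decided exactly).
Lt1 : ℚ√2 → Set
Lt1 (r + s √2) =
  (s ℚ.< 0ℚ × (0ℚ ℚ.≤ c ⊎ c ℚ.* c ℚ.< two ℚ.* (s ℚ.* s)))
  ⊎ (0ℚ ℚ.≤ s × 0ℚ ℚ.< c × two ℚ.* (s ℚ.* s) ℚ.< c ℚ.* c)
  where
  c = 1ℚ ℚ.- r
  two = 1ℚ ℚ.+ 1ℚ

absℚ : ℤ → ℚ
absℚ x = ℤ.+ ℤ.∣ x ∣ ℚ./ 1

-- With n = suc k, a_i = a (inject₁ j) for i = toℕ j + 1 (j : Fin k), a_n = a (fromℕ k).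
-- (Only meaningful for n ≥ 1; the case n = 0 is declared false.)
Represents : ℤ → (n : ℕ) → (Fin n → ℤ) → Set
Represents m zero a = ⊥
Represents m (suc k) a =
  m ≡ (ℤ.+ (2 ℕ.^ suc k) ℤ.+ ℤ.1ℤ)
      ℤ.+ Σℤ (λ (j : Fin k) → a (inject₁ j) ℤ.* (ℤ.+ (2 ℕ.^ (k ℕ.∸ toℕ j)) ℤ.+ ℤ.1ℤ))
      ℤ.+ a (fromℕ k)

OddLast : (n : ℕ) → (Fin n → ℤ) → Set
OddLast zero a = ⊥
OddLast (suc k) a = Oddℤ (a (fromℕ k))

weight2 : (n : ℕ) → (Fin n → ℤ) → ℚ√2
weight2 zero a = zero√2
weight2 (suc k) a =
  ((½ ℚ.* absℚ (a (fromℕ k))) ⊙ invSqrt2Pow (suc k))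
  ⊕ Σ√2 (λ (j : Fin k) → absℚ (a (inject₁ j)) ⊙ invSqrt2Pow (suc (toℕ j)))

{-# OPTIONS --safe #-}

-- Write m = (2^n + 1) + E with E = Σ a_i (2^{n-i} + 1) + a_n, and call a digit string light
-- if its last digit is odd and its weight r + s√2 has r, s ≥ 0 and is below 1. Prepending a
-- digit 0 to a string of length ℓ keeps E and divides the weight by √2; prepending 0, 1 adds
-- 2^ℓ + 1 to E and moves the weight w to (1 + w)/2; negating all digits negates E. All three
-- preserve lightness. So, from the tabulated lengths 4 and 5 on, every E with 3|E| ≤ 2^ℓ + 1
-- has a light expansion of length ℓ: if 3|E| ≤ 2^{ℓ-1} + 1 prepend 0 to one of length ℓ - 1,
-- and otherwise E = ±((2^{ℓ-2} + 1) + E') with 3|E'| ≤ 2^{ℓ-2} + 1. Likewise m lies within a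
-- third of 2^n + 1 for some 4 ≤ n ≤ d, unless m ≤ 11, which is tabulated.

module Submission where

open import Defs
open import Data.Nat using (ℕ; zero; suc; _<_; _≤_; _*_; _+_; _^_; _∸_; z≤n; s≤s; _≤?_; _<?_)
import Data.Nat.Properties as ℕ
open import Data.Nat.Tactic.RingSolver using (solve-∀)
open import Data.Integer as Z using (ℤ; +_; -[1+_]; 0ℤ; 1ℤ; ∣_∣)
import Data.Integer.Properties as ZP
import Data.Integer.Tactic.RingSolver as ℤ-Solver
open import Data.Rational as Q using (ℚ; 0ℚ; 1ℚ; ½)
import Data.Rational.Properties as QP
open import Data.Rational.Solver using (module +-*-Solver)
open import Data.Fin as F using (Fin; toℕ; inject₁; fromℕ)
open import Data.Vec.Functional using ([]; _∷_; map)
open import Data.Product using (Σ; ∃-syntax; _×_; _,_)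
open import Data.Sum using (inj₂)
open import Data.Empty using (⊥-elim)
open import Function using (_∘_)
open import Relation.Nullary using (Dec; yes; no)
open import Relation.Nullary.Decidable using (True; toWitness; from-yes; from-no; _×-dec_)
open import Relation.Binary.PropositionalEquality

two : ℚ
two = 1ℚ Q.+ 1ℚ

module _ where
  open QP
  open QP.≤-Reasoning
  open +-*-Solver

  square-mono-≤ : ∀ {p q} → 0ℚ Q.≤ p → p Q.≤ q → p Q.* p Q.≤ q Q.* q
  square-mono-≤ {p} {q} 0≤p p≤q = begin
    p Q.* p ≤⟨ *-monoˡ-≤-nonNeg p {{Q.nonNegative 0≤p}} p≤q ⟩
    p Q.* q ≤⟨ *-monoʳ-≤-nonNeg q {{Q.nonNegative (≤-trans 0≤p p≤q)}} p≤q ⟩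
    q Q.* q ∎

  square-mono-< : ∀ {p q} → 0ℚ Q.≤ p → p Q.< q → p Q.* p Q.< q Q.* q
  square-mono-< {p} {q} 0≤p p<q = begin-strict
    p Q.* p ≤⟨ *-monoˡ-≤-nonNeg p {{Q.nonNegative 0≤p}} (<⇒≤ p<q) ⟩
    p Q.* q <⟨ *-monoˡ-<-pos q {{Q.positive (≤-<-trans 0≤p p<q)}} p<q ⟩
    q Q.* q ∎

  p≤two*p : ∀ {p} → 0ℚ Q.≤ p → p Q.≤ two Q.* p
  p≤two*p {p} 0≤p = begin
    p          ≡⟨ sym (+-identityʳ p) ⟩
    p Q.+ 0ℚ   ≤⟨ +-monoʳ-≤ p 0≤p ⟩
    p Q.+ p    ≡⟨ solve 1 (λ p → p :+ p := con two :* p) refl p ⟩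
    two Q.* p  ∎

  <-of-two*square< : ∀ {p q} → 0ℚ Q.≤ p → 0ℚ Q.≤ q → two Q.* (p Q.* p) Q.< q Q.* q → p Q.< q
  <-of-two*square< {p} {q} 0≤p 0≤q 2p²<q² = ≰⇒> λ q≤p → <-irrefl refl (begin-strict
    q Q.* q            ≤⟨ square-mono-≤ 0≤q q≤p ⟩
    p Q.* p            ≤⟨ p≤two*p (square-mono-≤ ≤-refl 0≤p) ⟩
    two Q.* (p Q.* p)  <⟨ 2p²<q² ⟩
    q Q.* q            ∎)

  <-sub-swap : ∀ {p q r} → p Q.< q Q.- r → r Q.< q Q.- p
  <-sub-swap {p} {q} {r} p<q-r = begin-strict
    r                           ≡⟨ solve 2 (λ p r → r := p :+ (r :- p)) refl p r ⟩
    p Q.+ (r Q.- p)             <⟨ +-monoˡ-< (r Q.- p) p<q-r ⟩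
    (q Q.- r) Q.+ (r Q.- p)     ≡⟨ solve 3 (λ p q r → (q :- r) :+ (r :- p) := q :- p) refl p q r ⟩
    q Q.- p                     ∎

-- r + s√2 < 1 with r, s ≥ 0, squared so that it stays inside ℚ.
Below1⁺ : ℚ√2 → Set
Below1⁺ (r + s √2) =
  0ℚ Q.≤ r × 0ℚ Q.≤ s × 0ℚ Q.< 1ℚ Q.- r × two Q.* (s Q.* s) Q.< (1ℚ Q.- r) Q.* (1ℚ Q.- r)

Below1⁺? : ∀ w → Dec (Below1⁺ w)
Below1⁺? (r + s √2) =
  0ℚ Q.≤? r ×-dec 0ℚ Q.≤? s ×-dec 0ℚ Q.<? 1ℚ Q.- r
    ×-dec two Q.* (s Q.* s) Q.<? (1ℚ Q.- r) Q.* (1ℚ Q.- r)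

Below1⁺⇒Lt1 : ∀ {w} → Below1⁺ w → Lt1 w
Below1⁺⇒Lt1 (_ , 0≤s , 0<1-r , bound) = inj₂ (0≤s , 0<1-r , bound)

div√2 : ℚ√2 → ℚ√2
div√2 (r + s √2) = s + (½ Q.* r) √2

halfwayTo1 : ℚ√2 → ℚ√2
halfwayTo1 (r + s √2) = (½ Q.+ ½ Q.* r) + (½ Q.* s) √2

module _ where
  open QP
  open QP.≤-Reasoning
  open +-*-Solver

  div√2-Below1⁺ : ∀ {w} → Below1⁺ w → Below1⁺ (div√2 w)
  div√2-Below1⁺ {r + s √2} (0≤r , 0≤s , 0<1-r , bound) =
    0≤s , *-monoˡ-≤-nonNeg ½ 0≤r , ≤-<-trans 0≤r r<1-s , bound′
    where
    r<1-s : r Q.< 1ℚ Q.- s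
    r<1-s = <-sub-swap {q = 1ℚ} (<-of-two*square< 0≤s (<⇒≤ 0<1-r) bound)
    bound′ : two Q.* ((½ Q.* r) Q.* (½ Q.* r)) Q.< (1ℚ Q.- s) Q.* (1ℚ Q.- s)
    bound′ = begin-strict
      two Q.* ((½ Q.* r) Q.* (½ Q.* r))
        ≡⟨ solve 1 (λ r → con two :* ((con ½ :* r) :* (con ½ :* r)) := con ½ :* (r :* r)) refl r ⟩
      ½ Q.* (r Q.* r)
        ≤⟨ *-monoʳ-≤-nonNeg (r Q.* r) {{Q.nonNegative (square-mono-≤ ≤-refl 0≤r)}} (from-yes (½ Q.≤? 1ℚ)) ⟩
      1ℚ Q.* (r Q.* r)
        ≡⟨ *-identityˡ (r Q.* r) ⟩
      r Q.* r
        <⟨ square-mono-< 0≤r r<1-s ⟩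
      (1ℚ Q.- s) Q.* (1ℚ Q.- s) ∎

  halfwayTo1-Below1⁺ : ∀ {w} → Below1⁺ w → Below1⁺ (halfwayTo1 w)
  halfwayTo1-Below1⁺ {r + s √2} (0≤r , 0≤s , 0<1-r , bound) =
    +-mono-≤ (from-yes (0ℚ Q.≤? ½)) (*-monoˡ-≤-nonNeg ½ 0≤r) ,
    *-monoˡ-≤-nonNeg ½ 0≤s ,
    subst (0ℚ Q.<_) (sym 1-halfway) (*-monoʳ-<-pos ½ 0<1-r) ,
    bound′
    where
    1-halfway : 1ℚ Q.- (½ Q.+ ½ Q.* r) ≡ ½ Q.* (1ℚ Q.- r)
    1-halfway = solve 1 (λ r → con 1ℚ :- (con ½ :+ con ½ :* r) := con ½ :* (con 1ℚ :- r)) refl r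
    bound′ : two Q.* ((½ Q.* s) Q.* (½ Q.* s))
               Q.< (1ℚ Q.- (½ Q.+ ½ Q.* r)) Q.* (1ℚ Q.- (½ Q.+ ½ Q.* r))
    bound′ = begin-strict
      two Q.* ((½ Q.* s) Q.* (½ Q.* s))
        ≡⟨ solve 1 (λ s → con two :* ((con ½ :* s) :* (con ½ :* s))
                          := con ½ :* (con ½ :* (con two :* (s :* s)))) refl s ⟩
      ½ Q.* (½ Q.* (two Q.* (s Q.* s)))
        <⟨ *-monoʳ-<-pos ½ (*-monoʳ-<-pos ½ bound) ⟩
      ½ Q.* (½ Q.* ((1ℚ Q.- r) Q.* (1ℚ Q.- r)))
        ≡⟨ solve 1 (λ r → con ½ :* (con ½ :* ((con 1ℚ :- r) :* (con 1ℚ :- r)))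
                          := (con 1ℚ :- (con ½ :+ con ½ :* r)) :* (con 1ℚ :- (con ½ :+ con ½ :* r))) refl r ⟩
      (1ℚ Q.- (½ Q.+ ½ Q.* r)) Q.* (1ℚ Q.- (½ Q.+ ½ Q.* r)) ∎

⊕-identityˡ : ∀ x → zero√2 ⊕ x ≡ x
⊕-identityˡ (r + s √2) = cong₂ _+_√2 (QP.+-identityˡ r) (QP.+-identityˡ s)

x⊕yz≡y⊕xz : ∀ x y z → x ⊕ (y ⊕ z) ≡ y ⊕ (x ⊕ z)
x⊕yz≡y⊕xz (a + b √2) (c + d √2) (e + f √2) = cong₂ _+_√2 (exchange a c e) (exchange b d f)
  where
  open +-*-Solver
  exchange : ∀ p q r → p Q.+ (q Q.+ r) ≡ q Q.+ (p Q.+ r)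
  exchange = solve 3 (λ p q r → p :+ (q :+ r) := q :+ (p :+ r)) refl

div√2-⊕ : ∀ x y → div√2 (x ⊕ y) ≡ div√2 x ⊕ div√2 y
div√2-⊕ (a + b √2) (c + d √2) = cong ((b Q.+ d) +_√2) (QP.*-distribˡ-+ ½ a c)

div√2-⊙ : ∀ q x → div√2 (q ⊙ x) ≡ q ⊙ div√2 x
div√2-⊙ q (r + s √2) = cong ((q Q.* s) +_√2) (solve 2 (λ q r → con ½ :* (q :* r) := q :* (con ½ :* r)) refl q r)
  where open +-*-Solver

Σ√2-cong : ∀ {n} {f g : Fin n → ℚ√2} → (∀ j → f j ≡ g j) → Σ√2 f ≡ Σ√2 g
Σ√2-cong {zero} f≗g = refl
Σ√2-cong {suc n} f≗g = cong₂ _⊕_ (f≗g F.zero) (Σ√2-cong (f≗g ∘ F.suc))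

div√2-Σ√2 : ∀ {n} (f : Fin n → ℚ√2) → div√2 (Σ√2 f) ≡ Σ√2 (div√2 ∘ f)
div√2-Σ√2 {zero} f = refl
div√2-Σ√2 {suc n} f = trans (div√2-⊕ (f F.zero) (Σ√2 (f ∘ F.suc))) (cong (div√2 (f F.zero) ⊕_) (div√2-Σ√2 (f ∘ F.suc)))

invSqrt2Pow-suc : ∀ i → invSqrt2Pow (suc i) ≡ div√2 (invSqrt2Pow i)
invSqrt2Pow-suc zero = refl
invSqrt2Pow-suc (suc zero) = refl
invSqrt2Pow-suc (suc (suc i)) = trans (cong (½ ⊙_) (invSqrt2Pow-suc i)) (sym (div√2-⊙ ½ (invSqrt2Pow i)))

div√2-⊙invSqrt2Pow : ∀ q i → div√2 (q ⊙ invSqrt2Pow i) ≡ q ⊙ invSqrt2Pow (suc i)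
div√2-⊙invSqrt2Pow q i = trans (div√2-⊙ q (invSqrt2Pow i)) (cong (q ⊙_) (sym (invSqrt2Pow-suc i)))

absℚ-neg : ∀ x → absℚ (Z.- x) ≡ absℚ x
absℚ-neg x = cong (λ n → + n Q./ 1) (ZP.∣-i∣≡∣i∣ x)

weight2-∷ : ∀ k x (a : Fin (suc k) → ℤ) →
  weight2 (2 + k) (x ∷ a) ≡ (absℚ x ⊙ invSqrt2Pow 1) ⊕ div√2 (weight2 (suc k) a)
weight2-∷ k x a = begin
    last′ ⊕ (X ⊕ Σ√2 term′)   ≡⟨ x⊕yz≡y⊕xz last′ X (Σ√2 term′) ⟩
    X ⊕ (last′ ⊕ Σ√2 term′)   ≡⟨ cong (X ⊕_) (sym div√2-weight) ⟩
    X ⊕ div√2 (last ⊕ Σ√2 term) ∎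
  where
  open ≡-Reasoning
  X = absℚ x ⊙ invSqrt2Pow 1
  q = ½ Q.* absℚ (a (fromℕ k))
  last = q ⊙ invSqrt2Pow (suc k)
  last′ = q ⊙ invSqrt2Pow (2 + k)
  term term′ : Fin k → ℚ√2
  term j = absℚ (a (inject₁ j)) ⊙ invSqrt2Pow (suc (toℕ j))
  term′ j = absℚ (a (inject₁ j)) ⊙ invSqrt2Pow (2 + toℕ j)
  div√2-weight : div√2 (last ⊕ Σ√2 term) ≡ last′ ⊕ Σ√2 term′
  div√2-weight = trans (div√2-⊕ last (Σ√2 term)) (cong₂ _⊕_ (div√2-⊙invSqrt2Pow q (suc k))
    (trans (div√2-Σ√2 term) (Σ√2-cong (λ j → div√2-⊙invSqrt2Pow (absℚ (a (inject₁ j))) (suc (toℕ j))))))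

weight2-0∷ : ∀ k (a : Fin (suc k) → ℤ) → weight2 (2 + k) (0ℤ ∷ a) ≡ div√2 (weight2 (suc k) a)
weight2-0∷ k a = trans (weight2-∷ k 0ℤ a) (⊕-identityˡ (div√2 (weight2 (suc k) a)))

weight2-0∷1∷ : ∀ k (a : Fin (suc k) → ℤ) →
  weight2 (3 + k) (0ℤ ∷ 1ℤ ∷ a) ≡ halfwayTo1 (weight2 (suc k) a)
weight2-0∷1∷ k a = trans (weight2-0∷ (suc k) (1ℤ ∷ a)) (trans (cong div√2 (weight2-∷ k 1ℤ a))
  (cong (λ s → rat (halfwayTo1 w) + (½ Q.* s) √2) (QP.+-identityˡ (irr w))))
  where
  w = weight2 (suc k) a

weight2-neg : ∀ k (a : Fin (suc k) → ℤ) → weight2 (suc k) (map Z.-_ a) ≡ weight2 (suc k) a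
weight2-neg k a =
  cong₂ _⊕_ (cong (λ q → (½ Q.* q) ⊙ invSqrt2Pow (suc k)) (absℚ-neg (a (fromℕ k))))
            (Σ√2-cong (λ j → cong (_⊙ invSqrt2Pow (suc (toℕ j))) (absℚ-neg (a (inject₁ j)))))

Σℤ-cong : ∀ {n} {f g : Fin n → ℤ} → (∀ j → f j ≡ g j) → Σℤ f ≡ Σℤ g
Σℤ-cong {zero} f≗g = refl
Σℤ-cong {suc n} f≗g = cong₂ Z._+_ (f≗g F.zero) (Σℤ-cong (f≗g ∘ F.suc))

Σℤ-neg : ∀ {n} (f : Fin n → ℤ) → Σℤ (Z.-_ ∘ f) ≡ Z.- Σℤ f
Σℤ-neg {zero} f = refl
Σℤ-neg {suc n} f = trans (cong (Z._+_ (Z.- f F.zero)) (Σℤ-neg (f ∘ F.suc)))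
                         (sym (ZP.neg-distrib-+ (f F.zero) _))

Oddℤ-neg : ∀ {x} → Oddℤ x → Oddℤ (Z.- x)
Oddℤ-neg (t , refl) = Z.- t Z.- 1ℤ , negate-odd t
  where
  negate-odd : ∀ t → Z.- (+ 2 Z.* t Z.+ 1ℤ) ≡ + 2 Z.* (Z.- t Z.- 1ℤ) Z.+ 1ℤ
  negate-odd = ℤ-Solver.solve-∀

coefficient : (k : ℕ) → Fin k → ℤ
coefficient k j = + (2 ^ (k ∸ toℕ j)) Z.+ 1ℤ

-- When a represents m with n = suc k digits, m ≡ (2^n + 1) + value k a.
value : (k : ℕ) → (Fin (suc k) → ℤ) → ℤ
value k a = Σℤ (λ j → a (inject₁ j) Z.* coefficient k j) Z.+ a (fromℕ k)

value-∷ : ∀ k x (a : Fin (suc k) → ℤ) → value (suc k) (x ∷ a) ≡ x Z.* + (2 ^ suc k + 1) Z.+ value k a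
value-∷ k x a =
  ZP.+-assoc (x Z.* + (2 ^ suc k + 1)) (Σℤ (λ j → a (inject₁ j) Z.* coefficient k j)) (a (fromℕ k))

value-neg : ∀ k (a : Fin (suc k) → ℤ) → value k (map Z.-_ a) ≡ Z.- value k a
value-neg k a = begin
    Σℤ (λ j → Z.- a (inject₁ j) Z.* coefficient k j) Z.+ Z.- a (fromℕ k)
      ≡⟨ cong (Z._+ Z.- a (fromℕ k)) (trans (Σℤ-cong negˡ) (Σℤ-neg scaled)) ⟩
    Z.- Σℤ scaled Z.+ Z.- a (fromℕ k)
      ≡⟨ ZP.neg-distrib-+ (Σℤ scaled) (a (fromℕ k)) ⟨
    Z.- value k a ∎
  where
  open ≡-Reasoning
  scaled : Fin k → ℤ
  scaled j = a (inject₁ j) Z.* coefficient k j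
  negˡ : ∀ j → Z.- a (inject₁ j) Z.* coefficient k j ≡ Z.- scaled j
  negˡ j = sym (ZP.neg-distribˡ-* (a (inject₁ j)) (coefficient k j))

record Expansion (k : ℕ) (E : ℤ) : Set where
  field
    digits   : Fin (suc k) → ℤ
    value≡   : value k digits ≡ E
    last-odd : Oddℤ (digits (fromℕ k))
    light    : Below1⁺ (weight2 (suc k) digits)

open Expansion

Expansion-neg : ∀ {k E} → Expansion k E → Expansion k (Z.- E)
Expansion-neg {k} e = record
  { digits   = map Z.-_ (digits e)
  ; value≡   = trans (value-neg k (digits e)) (cong Z.-_ (value≡ e))
  ; last-odd = Oddℤ-neg (last-odd e)
  ; light    = subst Below1⁺ (sym (weight2-neg k (digits e))) (light e)
  }

Expansion-0∷ : ∀ {k E} → Expansion k E → Expansion (suc k) E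
Expansion-0∷ {k} {E} e = record
  { digits   = 0ℤ ∷ digits e
  ; value≡   = begin
      value (suc k) (0ℤ ∷ digits e)   ≡⟨ value-∷ k 0ℤ (digits e) ⟩
      0ℤ Z.+ value k (digits e)       ≡⟨ ZP.+-identityˡ _ ⟩
      value k (digits e)              ≡⟨ value≡ e ⟩
      E                               ∎
  ; last-odd = last-odd e
  ; light    = subst Below1⁺ (sym (weight2-0∷ k (digits e))) (div√2-Below1⁺ (light e))
  }
  where open ≡-Reasoning

Expansion-0∷1∷ : ∀ {k E} → Expansion k E → Expansion (2 + k) (+ (2 ^ suc k + 1) Z.+ E)
Expansion-0∷1∷ {k} {E} e = record
  { digits   = 0ℤ ∷ 1ℤ ∷ digits e
  ; value≡   = begin
      value (2 + k) (0ℤ ∷ 1ℤ ∷ digits e)              ≡⟨ value-∷ (suc k) 0ℤ (1ℤ ∷ digits e) ⟩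
      0ℤ Z.+ value (suc k) (1ℤ ∷ digits e)            ≡⟨ ZP.+-identityˡ _ ⟩
      value (suc k) (1ℤ ∷ digits e)                   ≡⟨ value-∷ k 1ℤ (digits e) ⟩
      1ℤ Z.* + (2 ^ suc k + 1) Z.+ value k (digits e) ≡⟨ cong₂ Z._+_ (ZP.*-identityˡ (+ (2 ^ suc k + 1))) (value≡ e) ⟩
      + (2 ^ suc k + 1) Z.+ E                         ∎
  ; last-odd = last-odd e
  ; light    = subst Below1⁺ (sym (weight2-0∷1∷ k (digits e))) (halfwayTo1-Below1⁺ (light e))
  }
  where open ≡-Reasoning

computed : ∀ {k} (a : Fin (suc k) → ℤ) → Oddℤ (a (fromℕ k)) →
  {True (Below1⁺? (weight2 (suc k) a))} → Expansion k (value k a)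
computed a odd {light} = record { digits = a ; value≡ = refl ; last-odd = odd ; light = toWitness light }

ExpandsUpTo : ℕ → Set
ExpandsUpTo k = ∀ e → 3 * e ≤ 2 ^ suc k + 1 → Expansion k (+ e)

expand : ∀ {k} → ExpandsUpTo k → ∀ E → 3 * ∣ E ∣ ≤ 2 ^ suc k + 1 → Expansion k E
expand expands (+ e) = expands e
expand expands -[1+ e ] = Expansion-neg ∘ expands (suc e)

3*n≤3*[n+e] : ∀ n e → 3 * n ≤ 3 * (n + e)
3*n≤3*[n+e] n e = ℕ.*-monoʳ-≤ 3 (ℕ.m≤m+n n e)

expands-3 : ExpandsUpTo 3
expands-3 0 _ = computed (+ 0 ∷ + 0 ∷ -[1+ 0 ] ∷ + 3 ∷ []) (+ 1 , refl)
expands-3 1 _ = computed (+ 0 ∷ + 0 ∷ + 0 ∷ + 1 ∷ []) (+ 0 , refl)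
expands-3 2 _ = computed (+ 0 ∷ + 0 ∷ + 1 ∷ -[1+ 0 ] ∷ []) (-[1+ 0 ] , refl)
expands-3 3 _ = computed (+ 0 ∷ + 0 ∷ + 0 ∷ + 3 ∷ []) (+ 1 , refl)
expands-3 4 _ = computed (+ 0 ∷ + 0 ∷ + 1 ∷ + 1 ∷ []) (+ 0 , refl)
expands-3 5 _ = computed (+ 0 ∷ + 0 ∷ + 0 ∷ + 5 ∷ []) (+ 2 , refl)
expands-3 (suc (suc (suc (suc (suc (suc e)))))) h =
  ⊥-elim (from-no (3 * 6 ≤? 2 ^ 4 + 1) (ℕ.≤-trans (3*n≤3*[n+e] 6 e) h))

expands-4 : ExpandsUpTo 4
expands-4 0 _ = computed (+ 0 ∷ + 0 ∷ + 0 ∷ -[1+ 0 ] ∷ + 3 ∷ []) (+ 1 , refl)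
expands-4 1 _ = computed (+ 0 ∷ + 0 ∷ + 0 ∷ + 0 ∷ + 1 ∷ []) (+ 0 , refl)
expands-4 2 _ = computed (+ 0 ∷ + 0 ∷ + 0 ∷ + 1 ∷ -[1+ 0 ] ∷ []) (-[1+ 0 ] , refl)
expands-4 3 _ = computed (+ 0 ∷ + 0 ∷ + 0 ∷ + 0 ∷ + 3 ∷ []) (+ 1 , refl)
expands-4 4 _ = computed (+ 0 ∷ + 0 ∷ + 0 ∷ + 1 ∷ + 1 ∷ []) (+ 0 , refl)
expands-4 5 _ = computed (+ 0 ∷ + 0 ∷ + 0 ∷ + 0 ∷ + 5 ∷ []) (+ 2 , refl)
expands-4 6 _ = computed (+ 0 ∷ + 0 ∷ + 1 ∷ + 0 ∷ + 1 ∷ []) (+ 0 , refl)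
expands-4 7 _ = computed (+ 0 ∷ + 0 ∷ + 0 ∷ + 2 ∷ + 1 ∷ []) (+ 0 , refl)
expands-4 8 _ = computed (+ 0 ∷ + 1 ∷ + 0 ∷ + 0 ∷ -[1+ 0 ] ∷ []) (-[1+ 0 ] , refl)
expands-4 9 _ = computed (+ 0 ∷ + 0 ∷ + 1 ∷ + 1 ∷ + 1 ∷ []) (+ 0 , refl)
expands-4 10 _ = computed (+ 0 ∷ + 1 ∷ + 0 ∷ + 0 ∷ + 1 ∷ []) (+ 0 , refl)
expands-4 11 _ = computed (+ 0 ∷ + 0 ∷ + 2 ∷ + 0 ∷ + 1 ∷ []) (+ 0 , refl)
expands-4 (suc (suc (suc (suc (suc (suc (suc (suc (suc (suc (suc (suc e)))))))))))) h =
  ⊥-elim (from-no (3 * 12 ≤? 2 ^ 5 + 1) (ℕ.≤-trans (3*n≤3*[n+e] 12 e) h))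

near-pivot : ∀ N e → 2 * N ≤ 3 * e → 3 * e ≤ 4 * N → ∃[ E ] 3 * ∣ E ∣ ≤ N × + e ≡ + N Z.+ E
near-pivot N e lower upper with N ≤? e
... | yes N≤e = + (e ∸ N) , bound , cong +_ (sym (ℕ.m+[n∸m]≡n N≤e))
  where
  open ℕ.≤-Reasoning
  bound : 3 * (e ∸ N) ≤ N
  bound = begin
    3 * (e ∸ N)      ≡⟨ ℕ.*-distribˡ-∸ 3 e N ⟩
    3 * e ∸ 3 * N    ≤⟨ ℕ.∸-monoˡ-≤ (3 * N) upper ⟩
    4 * N ∸ 3 * N    ≡⟨ ℕ.m+n∸n≡m N (3 * N) ⟩
    N                ∎
... | no N≰e = Z.- + (N ∸ e) , bound , trans (add-sub (+ e) (+ (N ∸ e))) (cong (λ n → + n Z.- + (N ∸ e)) e+[N∸e]≡N)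
  where
  open ℕ.≤-Reasoning
  e+[N∸e]≡N : e + (N ∸ e) ≡ N
  e+[N∸e]≡N = ℕ.m+[n∸m]≡n (ℕ.<⇒≤ (ℕ.≰⇒> N≰e))
  add-sub : ∀ x y → x ≡ x Z.+ y Z.- y
  add-sub = ℤ-Solver.solve-∀
  bound : 3 * ∣ Z.- + (N ∸ e) ∣ ≤ N
  bound = begin
    3 * ∣ Z.- + (N ∸ e) ∣  ≡⟨ cong (3 *_) (ZP.∣-i∣≡∣i∣ (+ (N ∸ e))) ⟩
    3 * (N ∸ e)            ≡⟨ ℕ.*-distribˡ-∸ 3 N e ⟩
    3 * N ∸ 3 * e          ≤⟨ ℕ.∸-monoʳ-≤ (3 * N) lower ⟩
    3 * N ∸ 2 * N          ≡⟨ ℕ.m+n∸n≡m N (2 * N) ⟩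
    N                      ∎

near-pivot-suc : ∀ Q e → 2 * Q + 1 < 3 * e → 3 * e ≤ 4 * Q + 3 →
  ∃[ E ] 3 * ∣ E ∣ ≤ Q + 1 × + e ≡ + (Q + 1) Z.+ E
near-pivot-suc Q e lower upper = near-pivot (Q + 1) e
  (subst (_≤ 3 * e) (double-suc Q) lower)
  (subst (3 * e ≤_) (quadruple-suc Q) (ℕ.m≤n⇒m≤1+n upper))
  where
  double-suc : ∀ Q → suc (2 * Q + 1) ≡ 2 * (Q + 1)
  double-suc = solve-∀
  quadruple-suc : ∀ Q → suc (4 * Q + 3) ≡ 4 * (Q + 1)
  quadruple-suc = solve-∀

2*[2*n]+1<4*n+3 : ∀ n → 2 * (2 * n) + 1 < 4 * n + 3
2*[2*n]+1<4*n+3 n = subst (suc (2 * (2 * n) + 1) ≤_) (identity n) (ℕ.m≤m+n _ 1)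
  where
  identity : ∀ n → suc (2 * (2 * n) + 1) + 1 ≡ 4 * n + 3
  identity = solve-∀

expands-step : ∀ {k} → ExpandsUpTo k → ExpandsUpTo (suc k) → ExpandsUpTo (2 + k)
expands-step {k} expands expands′ e 3e≤ with 3 * e ≤? 2 ^ (2 + k) + 1
... | yes small = Expansion-0∷ (expands′ e small)
... | no ¬small with near-pivot-suc (2 ^ suc k) e (ℕ.≰⇒> ¬small)
                       (ℕ.≤-trans 3e≤ (ℕ.<⇒≤ (2*[2*n]+1<4*n+3 (2 ^ suc k))))
...   | E , bound , e≡ = subst (Expansion (2 + k)) (sym e≡) (Expansion-0∷1∷ (expand expands E bound))

expands : ∀ j → ExpandsUpTo (3 + j)
expands zero = expands-3
expands (suc zero) = expands-4
expands (suc (suc j)) = expands-step (expands j) (expands (suc j))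

Solution : ℕ → ℕ → Set
Solution d m = ∃[ n ] Σ (Fin n → ℤ) λ a →
  1 ≤ n × n ≤ d × Represents (+ m) n a × OddLast n a × Lt1 (weight2 n a)

solution : ∀ {k E d m} → Expansion k E → + m ≡ + (2 ^ suc k + 1) Z.+ E → suc k ≤ d → Solution d m
solution {k} e m≡ k<d = suc k , digits e , s≤s z≤n , k<d ,
  trans m≡ (trans (cong (Z._+_ leading) (sym (value≡ e))) (sym (ZP.+-assoc leading sum (digits e (fromℕ k))))) ,
  last-odd e , Below1⁺⇒Lt1 (light e)
  where
  leading = + (2 ^ suc k + 1)
  sum = Σℤ (λ j → digits e (inject₁ j) Z.* coefficient k j)

Solution-weaken : ∀ {d m} → Solution d m → Solution (suc d) m
Solution-weaken (n , a , 1≤n , n≤d , rest) = n , a , 1≤n , ℕ.m≤n⇒m≤1+n n≤d , rest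

small-solutions : ∀ m → 0 < m → 3 * m < 4 * 2 ^ 3 + 3 → Solution 3 m
small-solutions 1 _ _ = solution (computed (-[1+ 0 ] ∷ -[1+ 0 ] ∷ []) (-[1+ 0 ] , refl)) refl (ℕ.m≤m+n 2 1)
small-solutions 2 _ _ = solution (computed (-[1+ 0 ] ∷ []) (-[1+ 0 ] , refl)) refl (ℕ.m≤m+n 1 2)
small-solutions 3 _ _ = solution (computed (-[1+ 0 ] ∷ + 1 ∷ []) (+ 0 , refl)) refl (ℕ.m≤m+n 2 1)
small-solutions 4 _ _ = solution (computed (+ 1 ∷ []) (+ 0 , refl)) refl (ℕ.m≤m+n 1 2)
small-solutions 5 _ _ = solution (computed (+ 0 ∷ -[1+ 0 ] ∷ -[1+ 0 ] ∷ []) (-[1+ 0 ] , refl)) refl ℕ.≤-refl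
small-solutions 6 _ _ = solution (computed (+ 0 ∷ + 1 ∷ []) (+ 0 , refl)) refl (ℕ.m≤m+n 2 1)
small-solutions 7 _ _ = solution (computed (+ 1 ∷ -[1+ 0 ] ∷ []) (-[1+ 0 ] , refl)) refl (ℕ.m≤m+n 2 1)
small-solutions 8 _ _ = solution (computed (+ 0 ∷ + 3 ∷ []) (+ 1 , refl)) refl (ℕ.m≤m+n 2 1)
small-solutions 9 _ _ = solution (computed (+ 1 ∷ + 1 ∷ []) (+ 0 , refl)) refl (ℕ.m≤m+n 2 1)
small-solutions 10 _ _ = solution (computed (+ 0 ∷ + 0 ∷ + 1 ∷ []) (+ 0 , refl)) refl ℕ.≤-refl
small-solutions 11 _ _ = solution (computed (+ 0 ∷ + 1 ∷ -[1+ 0 ] ∷ []) (-[1+ 0 ] , refl)) refl ℕ.≤-refl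
small-solutions (suc (suc (suc (suc (suc (suc (suc (suc (suc (suc (suc (suc m)))))))))))) _ h =
  ⊥-elim (from-no (3 * 12 <? 4 * 2 ^ 3 + 3) (ℕ.≤-<-trans (3*n≤3*[n+e] 12 m) h))

solutions : ∀ j m → 0 < m → 3 * m < 4 * 2 ^ (3 + j) + 3 → Solution (3 + j) m
solutions zero = small-solutions
solutions (suc j) m 0<m 3m< with 3 * m <? 4 * 2 ^ (3 + j) + 3
... | yes 3m<′ = Solution-weaken (solutions j m 0<m 3m<′)
... | no 3m≮ with near-pivot-suc (2 ^ (4 + j)) m
                    (ℕ.<-≤-trans (2*[2*n]+1<4*n+3 (2 ^ (3 + j))) (ℕ.≮⇒≥ 3m≮)) (ℕ.<⇒≤ 3m<)
...   | E , bound , m≡ = solution (expand (expands j) E bound) m≡ ℕ.≤-refl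

lemma2p3 : (m d : ℕ) → 0 < m → 2 < d → 3 * m < 4 * 2 ^ d + 3 →
    ∃[ n ] Σ (Fin n → ℤ) λ a →
      1 ≤ n × n ≤ d × Represents (+ m) n a × OddLast n a × Lt1 (weight2 n a)
lemma2p3 m (suc (suc (suc j))) 0<m _ 3m< = solutions j m 0<m 3m<
lemma2p3 m 0 _ () _
lemma2p3 m 1 _ (s≤s ()) _
lemma2p3 m 2 _ (s≤s (s≤s ())) _
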